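{- Let $m,n$ be positive integers with $m \equiv 9 \pmod{16}$ and $n \equiv 9 \pmod{16}$. Then $K_m \Box K_n$ has an $L_8$-decomposition.
   Context: $K_m$ is the complete graph on $m$ vertices. The Cartesian product $G \Box H$ has vertex set $V(G)\times V(H)$, with $(g,h)$ adjacent to $(g',h')$ iff either $g=g'$ and $hh'\in E(H)$, or $h=h'$ and $gg'\in E(G)$. The sunlet graph $L_8$ is the graph on 8 vertices $x_1,\dots,x_8$ with edge set $\{x_1x_2,x_2x_3,x_3x_4,x_4x_1,x_1x_5,x_2x_6,x_3x_7,x_4x_8\}$. An $L_8$-decomposition of a graph $G$ is a partition of $E(G)$ into sets each inducing a subgraph isomorphic to $L_8$. -}

module Defs where

open import Data.Nat using (ℕ)
open import Data.Fin using (Fin; zero; suc)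
open import Data.Fin.Patterns
open import Data.Product using (Σ; _×_; _,_; proj₁; proj₂)
open import Data.Sum using (_⊎_)
open import Relation.Binary.PropositionalEquality using (_≡_)
open import Relation.Nullary using (¬_)
open import Function.Definitions using (Injective)

KmBoxKn-Adj : (m n : ℕ) → Fin m × Fin n → Fin m × Fin n → Set
KmBoxKn-Adj m n (g , h) (g' , h') =
  (g ≡ g' × ¬ (h ≡ h')) ⊎ (h ≡ h' × ¬ (g ≡ g'))

-- Edges of the sunlet graph L_8 on vertices x_1..x_8 (encoded as 0..7):
-- x1x2, x2x3, x3x4, x4x1, x1x5, x2x6, x3x7, x4x8
L8-edge : Fin 8 → Fin 8 × Fin 8
L8-edge 0F = 0F , 1F
L8-edge 1F = 1F , 2F
L8-edge 2F = 2F , 3F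
L8-edge 3F = 3F , 0F
L8-edge 4F = 0F , 4F
L8-edge 5F = 1F , 5F
L8-edge 6F = 2F , 6F
L8-edge 7F = 3F , 7F

-- An L_8-decomposition of a graph with vertex type V and (symmetric) adjacency Adj:
-- finitely many copies of L_8 (injective vertex maps sending L_8-edges to edges),
-- such that every edge {u,v} of the graph is the image of exactly one
-- (copy, L_8-edge) pair. This is exactly a partition of E(G) into edge sets
-- each inducing a subgraph isomorphic to L_8.
record L8-Decomposition {V : Set} (Adj : V → V → Set) : Set where
  field
    k     : ℕ
    copy  : Fin k → Fin 8 → V
    injective : ∀ c → Injective _≡_ _≡_ (copy c)
    edge-ok : ∀ c e →
      Adj (copy c (proj₁ (L8-edge e))) (copy c (proj₂ (L8-edge e)))

  Covers : Fin k → Fin 8 → V → V → Set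
  Covers c e u v =
    (copy c (proj₁ (L8-edge e)) ≡ u × copy c (proj₂ (L8-edge e)) ≡ v) ⊎
    (copy c (proj₁ (L8-edge e)) ≡ v × copy c (proj₂ (L8-edge e)) ≡ u)

  field
    covered : ∀ u v → Adj u v → Σ (Fin k) λ c → Σ (Fin 8) λ e → Covers c e u v
    unique  : ∀ u v → Adj u v → ∀ c e c' e' →
      Covers c e u v → Covers c' e' u v → (c ≡ c') × (e ≡ e')

module Submission where

-- The proof is the difference method. Write m = 2M+1, n = 2N+1 and view the
-- vertices as the group ℤ/m × ℤ/n. Every edge is a short step: a shift of
-- one coordinate by some d with 1 ≤ d ≤ M (resp. N), and the unordered edge
-- determines the direction and length of the step and where it starts
-- (ShortSteps, Torus). Hence, if base copies of L_8 drawn in ℕ² carry every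
-- admissible (direction, length) on exactly one edge, their translates by
-- all vertices partition the edge set (Torus.develop). For M = 8a+4 and
-- N = 8b+4 such a family consists of a mixed block for the lengths 1, …, 4
-- in both directions, and line blocks lying in one row or column, each for
-- eight consecutive lengths 8j+5, …, 8j+12 (Family). The theorem follows by
-- writing m = 2(8⌊m/16⌋ + 4) + 1.

open import Defs
open import Data.Nat
  using (ℕ; suc; z≤n; s≤s; z<s; _+_; _*_; _∸_; _%_; _≤_; _<_; _≥_; _≤?_; NonZero)
open import Data.Nat.Properties
open import Data.Nat.DivMod
  using (_mod_; _/_; m≡m%n+[m/n]*n; %-distribˡ-+; m%n%n≡m%n; [m+n]%n≡m%n; m<n⇒m%n≡m)
open import Data.Nat.Tactic.RingSolver using (solve-∀)
open import Data.Fin using (Fin; toℕ; fromℕ<; fromℕ; splitAt; join; combine; remQuot)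
  renaming (zero to fzero; suc to fsuc)
open import Data.Fin.Patterns
open import Data.Fin.Properties
  using (toℕ-injective; toℕ<n; toℕ-fromℕ<; *↔×; splitAt-join; join-splitAt; toℕ-combine;
         combine-injective; combine-remQuot)
import Data.Fin.Properties as Fin
open import Data.Vec using (Vec; []; _∷_; lookup)
open import Data.Vec.Relation.Unary.Linked using (Linked; [-]; _∷_)
import Data.Vec.Relation.Unary.Linked.Properties as Linked
open import Data.Product using (Σ; _×_; _,_; proj₁; proj₂)
open import Data.Product.Function.NonDependent.Propositional using (_×-↔_)
open import Data.Sum using (_⊎_; inj₁; inj₂; [_,_]′)
open import Data.Empty using (⊥-elim)
open import Function.Base using (_∘_)
open import Function.Bundles using (_↔_; Inverse; Injection; mk↔ₛ′)
open import Function.Properties.Inverse using (↔⇒↣; ↔-trans)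
open import Function.Definitions using (Injective)
open import Relation.Binary.Definitions using (tri<; tri≈; tri>)
open import Relation.Binary.PropositionalEquality
open import Relation.Nullary using (yes; no)

SameEdge : {V : Set} → V → V → V → V → Set
SameEdge a b u v = (a ≡ u × b ≡ v) ⊎ (a ≡ v × b ≡ u)

module _ {V : Set} where

  sameEdge-sym : {a b u v : V} → SameEdge a b u v → SameEdge u v a b
  sameEdge-sym (inj₁ (p , q)) = inj₁ (sym p , sym q)
  sameEdge-sym (inj₂ (p , q)) = inj₂ (sym q , sym p)

  sameEdge-swap : {a b u v : V} → SameEdge a b v u → SameEdge a b u v
  sameEdge-swap (inj₁ (p , q)) = inj₂ (p , q)
  sameEdge-swap (inj₂ (p , q)) = inj₁ (p , q)

  sameEdge-trans : {a b u v x y : V} → SameEdge a b u v → SameEdge u v x y → SameEdge a b x y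
  sameEdge-trans (inj₁ (refl , refl)) s = s
  sameEdge-trans (inj₂ (refl , refl)) s = sameEdge-sym (sameEdge-swap (sameEdge-sym s))

sameEdge-map : {V W : Set} (f : V → W) {a b u v : V} →
  SameEdge a b u v → SameEdge (f a) (f b) (f u) (f v)
sameEdge-map f (inj₁ (p , q)) = inj₁ (cong f p , cong f q)
sameEdge-map f (inj₂ (p , q)) = inj₂ (cong f p , cong f q)

src tgt : Fin 8 → Fin 8
src e = proj₁ (L8-edge e)
tgt e = proj₂ (L8-edge e)

data Orientation : Set where
  forward backward : Orientation

tail head : Orientation → Fin 8 → Fin 8
tail forward  = src
tail backward = tgt
head forward  = tgt
head backward = src

oriented-ends : {V : Set} (f : Fin 8 → V) (o : Orientation) (e : Fin 8) →
  SameEdge (f (tail o e)) (f (head o e)) (f (src e)) (f (tgt e))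
oriented-ends f forward  e = inj₁ (refl , refl)
oriented-ends f backward e = inj₂ (refl , refl)

record IndexedL8-Decomposition {V : Set} (Adj : V → V → Set) (I : Set) : Set where
  field
    copy      : I → Fin 8 → V
    injective : ∀ c → Injective _≡_ _≡_ (copy c)
    edge-ok   : ∀ c e → Adj (copy c (src e)) (copy c (tgt e))

  Covers : I → Fin 8 → V → V → Set
  Covers c e u v = SameEdge (copy c (src e)) (copy c (tgt e)) u v

  field
    covered   : ∀ u v → Adj u v → Σ I λ c → Σ (Fin 8) λ e → Covers c e u v
    unique    : ∀ u v → Adj u v → ∀ c e c' e' → Covers c e u v → Covers c' e' u v → c ≡ c' × e ≡ e'

reindex : ∀ {V : Set} {Adj : V → V → Set} {I : Set} {k : ℕ} →
  Fin k ↔ I → IndexedL8-Decomposition Adj I → L8-Decomposition Adj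
reindex {k = k} enum D = record
  { k         = k
  ; copy      = copy ∘ to
  ; injective = injective ∘ to
  ; edge-ok   = edge-ok ∘ to
  ; covered   = λ u v a → let (c , e , s) = covered u v a in
      from c , e , subst (λ c → Covers c e u v) (sym (strictlyInverseˡ c)) s
  ; unique    = λ u v a c e c' e' s s' →
      let (c≡c' , e≡e') = unique u v a (to c) e (to c') e' s s'
      in Injection.injective (↔⇒↣ enum) c≡c' , e≡e'
  }
  where
  open Inverse enum
  open IndexedL8-Decomposition D

module Cyclic (n : ℕ) .{{_ : NonZero n}} where

  -- Kept opaque: everything below is derived from toℕ-shift.
  opaque
    shift : Fin n → ℕ → Fin n
    shift y a = (toℕ y + a) mod n

    toℕ-shift : ∀ y a → toℕ (shift y a) ≡ (toℕ y + a) % n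
    toℕ-shift y a = toℕ-fromℕ< _

    shift-≡ : ∀ y a y' a' → (toℕ y + a) % n ≡ (toℕ y' + a') % n → shift y a ≡ shift y' a'
    shift-≡ y a y' a' eq =
      toℕ-injective (trans (toℕ-shift y a) (trans eq (sym (toℕ-shift y' a'))))

    shift-0 : ∀ y → shift y 0 ≡ y
    shift-0 y = toℕ-injective (trans (toℕ-shift y 0)
      (trans (cong (_% n) (+-identityʳ (toℕ y))) (m<n⇒m%n≡m (toℕ<n y))))

  shift-n : ∀ y → shift y n ≡ shift y 0
  shift-n y = shift-≡ y n y 0
    (trans ([m+n]%n≡m%n (toℕ y) n) (cong (_% n) (sym (+-identityʳ (toℕ y)))))

  shift-+ : ∀ y a b → shift y (a + b) ≡ shift (shift y a) b
  shift-+ y a b = shift-≡ y (a + b) (shift y a) b (begin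
    (toℕ y + (a + b)) % n                  ≡⟨ cong (_% n) (+-assoc (toℕ y) a b) ⟨
    (toℕ y + a + b) % n                    ≡⟨ %-distribˡ-+ (toℕ y + a) b n ⟩
    ((toℕ y + a) % n + b % n) % n          ≡⟨ cong (λ r → (r + b % n) % n) (m%n%n≡m%n (toℕ y + a) n) ⟨
    ((toℕ y + a) % n % n + b % n) % n      ≡⟨ %-distribˡ-+ ((toℕ y + a) % n) b n ⟨
    ((toℕ y + a) % n + b) % n              ≡⟨ cong (λ r → (r + b) % n) (toℕ-shift y a) ⟨
    (toℕ (shift y a) + b) % n              ∎)
    where open ≡-Reasoning

  shift-comm : ∀ x y → shift x (toℕ y) ≡ shift y (toℕ x)
  shift-comm x y = shift-≡ x (toℕ y) y (toℕ x) (cong (_% n) (+-comm (toℕ x) (toℕ y)))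

  shift-back : ∀ {a} → a ≤ n → ∀ y → shift (shift y a) (n ∸ a) ≡ y
  shift-back {a} a≤n y = begin
    shift (shift y a) (n ∸ a)   ≡⟨ shift-+ y a (n ∸ a) ⟨
    shift y (a + (n ∸ a))       ≡⟨ cong (shift y) (m+[n∸m]≡n a≤n) ⟩
    shift y n                   ≡⟨ shift-n y ⟩
    shift y 0                   ≡⟨ shift-0 y ⟩
    y                           ∎
    where open ≡-Reasoning

  shift-forth : ∀ {a} → a ≤ n → ∀ y → shift (shift y (n ∸ a)) a ≡ y
  shift-forth {a} a≤n y = begin
    shift (shift y (n ∸ a)) a   ≡⟨ shift-+ y (n ∸ a) a ⟨
    shift y (n ∸ a + a)         ≡⟨ cong (shift y) (m∸n+n≡m a≤n) ⟩
    shift y n                   ≡⟨ shift-n y ⟩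
    shift y 0                   ≡⟨ shift-0 y ⟩
    y                           ∎
    where open ≡-Reasoning

  shift-cancelʳ : ∀ {a y y'} → a ≤ n → shift y a ≡ shift y' a → y ≡ y'
  shift-cancelʳ {a} {y} {y'} a≤n eq =
    trans (sym (shift-back a≤n y)) (trans (cong (λ z → shift z (n ∸ a)) eq) (shift-back a≤n y'))

  shift-cancelˡ : ∀ {y a a'} → a < n → a' < n → shift y a ≡ shift y a' → a ≡ a'
  shift-cancelˡ {y} {a} {a'} a<n a'<n eq = begin
    a                    ≡⟨ toℕ-fromℕ< a<n ⟨
    toℕ (fromℕ< a<n)     ≡⟨ cong toℕ (shift-cancelʳ (<⇒≤ (toℕ<n y)) (begin
      shift (fromℕ< a<n) (toℕ y)             ≡⟨ shift-comm (fromℕ< a<n) y ⟩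
      shift y (toℕ (fromℕ< a<n))             ≡⟨ cong (shift y) (toℕ-fromℕ< a<n) ⟩
      shift y a                              ≡⟨ eq ⟩
      shift y a'                             ≡⟨ cong (shift y) (toℕ-fromℕ< a'<n) ⟨
      shift y (toℕ (fromℕ< a'<n))            ≡⟨ shift-comm y (fromℕ< a'<n) ⟩
      shift (fromℕ< a'<n) (toℕ y)            ∎)) ⟩
    toℕ (fromℕ< a'<n)    ≡⟨ toℕ-fromℕ< a'<n ⟩
    a'                   ∎
    where open ≡-Reasoning

  distance : ∀ h h' → Σ ℕ λ d → d < n × shift h d ≡ h'
  distance h h' = toℕ (shift h' (n ∸ toℕ h)) , toℕ<n _ ,
    trans (shift-comm h _) (shift-forth (<⇒≤ (toℕ<n h)) h')

-- In a cycle of odd length 2N+1 every pair of distinct residues {h , h'}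
-- is joined by exactly one "short step": a shift by some d with 1 ≤ d ≤ N,
-- taken either from h or from h', and never both.

module ShortSteps (N : ℕ) where

  n : ℕ
  n = suc (N + N)

  open Cyclic n public

  Short : ℕ → Set
  Short d = 1 ≤ d × d ≤ N

  short<n : ∀ {d} → d ≤ N → d < n
  short<n d≤N = s≤s (≤-trans d≤N (m≤m+n _ _))

  short-moves : ∀ {d} h → Short d → shift h d ≢ h
  short-moves {d} h (1≤d , d≤N) eq =
    1+n≰n (≤-trans 1≤d (≤-reflexive d≡0))
    where
    d≡0 : d ≡ 0
    d≡0 = shift-cancelˡ (short<n d≤N) (s≤s z≤n) (trans eq (sym (shift-0 h)))

  short-exists : ∀ {h h'} → h ≢ h' →
    Σ ℕ λ d → Short d × (shift h d ≡ h' ⊎ shift h' d ≡ h)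
  short-exists {h} {h'} h≢h' with distance h h'
  ... | d , d<n , eq with d ≤? N
  ...   | yes d≤N = d , (n≢0⇒n>0 d≢0 , d≤N) , inj₁ eq
    where
    d≢0 : d ≢ 0
    d≢0 refl = h≢h' (trans (sym (shift-0 h)) eq)
  ...   | no d≰N = n ∸ d , (m<n⇒0<n∸m d<n , n∸d≤N) , inj₂ (begin
      shift h' (n ∸ d)            ≡⟨ cong (λ z → shift z (n ∸ d)) eq ⟨
      shift (shift h d) (n ∸ d)   ≡⟨ shift-back (<⇒≤ d<n) h ⟩
      h                           ∎)
    where
    open ≡-Reasoning
    n∸d≤N : n ∸ d ≤ N
    n∸d≤N = ≤-trans (∸-monoʳ-≤ n (≰⇒> d≰N)) (≤-reflexive (m+n∸m≡n N N))

  short-unique : ∀ {d d' p q p' q'} → Short d → Short d' →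
    shift p d ≡ q → shift p' d' ≡ q' → SameEdge p q p' q' → d ≡ d' × p ≡ p'
  short-unique (_ , d≤N) (_ , d'≤N) refl refl (inj₁ (refl , eq)) =
    shift-cancelˡ (short<n d≤N) (short<n d'≤N) eq , refl
  short-unique {d} {d'} {p} {q} {p'} (1≤d , d≤N) (_ , d'≤N) refl refl (inj₂ (p≡q' , q≡p')) =
    ⊥-elim (1+n≰n (≤-trans 1≤d (≤-trans (m≤m+n d d') (≤-reflexive d+d'≡0))))
    where
    round-trip : shift p (d + d') ≡ shift p 0
    round-trip = begin
      shift p (d + d')           ≡⟨ shift-+ p d d' ⟩
      shift (shift p d) d'       ≡⟨ cong (λ z → shift z d') q≡p' ⟩
      shift p' d'                ≡⟨ p≡q' ⟨
      p                          ≡⟨ shift-0 p ⟨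
      shift p 0                  ∎
      where open ≡-Reasoning
    d+d'≡0 : d + d' ≡ 0
    d+d'≡0 = shift-cancelˡ (s≤s (+-mono-≤ d≤N d'≤N)) (s≤s z≤n) round-trip

data Dir : Set where
  row col : Dir

Label : Set
Label = Dir × ℕ

-- An edge of a base block in ℕ²: a row or column displacement by d.
Displace : Label → ℕ × ℕ → ℕ × ℕ → Set
Displace (row , d) (p₁ , p₂) (q₁ , q₂) = q₁ ≡ p₁ × q₂ ≡ p₂ + d
Displace (col , d) (p₁ , p₂) (q₁ , q₂) = q₂ ≡ p₂ × q₁ ≡ p₁ + d

module Torus (M N : ℕ) where

  module Rows = ShortSteps N
  module Cols = ShortSteps M

  m n : ℕ
  m = Cols.n
  n = Rows.n

  V : Set
  V = Fin m × Fin n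

  Adj : V → V → Set
  Adj = KmBoxKn-Adj m n

  Admissible : Label → Set
  Admissible (row , d) = Rows.Short d
  Admissible (col , d) = Cols.Short d

  Move : Label → V → V → Set
  Move (row , d) (g , h) (g' , h') = g' ≡ g × Rows.shift h d ≡ h'
  Move (col , d) (g , h) (g' , h') = h' ≡ h × Cols.shift g d ≡ g'

  Step : Label → V → V → Set
  Step c u v = Admissible c × Move c u v

  adj-sym : ∀ {u v} → Adj u v → Adj v u
  adj-sym (inj₁ (g≡g' , h≢h')) = inj₁ (sym g≡g' , h≢h' ∘ sym)
  adj-sym (inj₂ (h≡h' , g≢g')) = inj₂ (sym h≡h' , g≢g' ∘ sym)

  adj-sameEdge : ∀ {a b u v} → SameEdge a b u v → Adj u v → Adj a b
  adj-sameEdge (inj₁ (refl , refl)) adj = adj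
  adj-sameEdge (inj₂ (refl , refl)) adj = adj-sym adj

  step-adjacent : ∀ {c u v} → Step c u v → Adj u v
  step-adjacent {row , d} {g , h} (short , refl , refl) = inj₁ (refl , Rows.short-moves h short ∘ sym)
  step-adjacent {col , d} {g , h} (short , refl , refl) = inj₂ (refl , Cols.short-moves g short ∘ sym)

  adjacent-step : ∀ {u v} → Adj u v → Σ Label λ c → Step c u v ⊎ Step c v u
  adjacent-step (inj₁ (refl , h≢h')) with Rows.short-exists h≢h'
  ... | d , short , inj₁ eq = (row , d) , inj₁ (short , refl , eq)
  ... | d , short , inj₂ eq = (row , d) , inj₂ (short , refl , eq)
  adjacent-step (inj₂ (refl , g≢g')) with Cols.short-exists g≢g'
  ... | d , short , inj₁ eq = (col , d) , inj₁ (short , refl , eq)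
  ... | d , short , inj₂ eq = (col , d) , inj₂ (short , refl , eq)

  move-functional : ∀ {c u v v'} → Move c u v → Move c u v' → v ≡ v'
  move-functional {row , d} (refl , refl) (refl , refl) = refl
  move-functional {col , d} (refl , refl) (refl , refl) = refl

  step-unique : ∀ {c c' u v u' v'} → Step c u v → Step c' u' v' →
    SameEdge u v u' v' → c ≡ c' × u ≡ u'
  step-unique {row , d} {row , d'} (short , refl , eq) (short' , refl , eq') same
    with Rows.short-unique short short' eq eq' (sameEdge-map proj₂ same) | same
  ... | refl , refl | inj₁ (refl , _) = refl , refl
  ... | refl , refl | inj₂ (refl , _) = refl , refl
  step-unique {col , d} {col , d'} (short , refl , eq) (short' , refl , eq') same
    with Cols.short-unique short short' eq eq' (sameEdge-map proj₁ same) | same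
  ... | refl , refl | inj₁ (_ , refl) = refl , refl
  ... | refl , refl | inj₂ (_ , refl) = refl , refl
  step-unique {row , d} {col , d'} {g , h} (short , refl , eq) (short' , refl , eq') same =
    ⊥-elim (Rows.short-moves h short (trans eq (row-ends same)))
    where
    row-ends : ∀ {x y z w} → SameEdge (g , h) (g , x) (y , z) (w , z) → x ≡ h
    row-ends (inj₁ (refl , refl)) = refl
    row-ends (inj₂ (refl , refl)) = refl
  step-unique {col , d} {row , d'} {g , h} (short , refl , eq) (short' , refl , eq') same =
    ⊥-elim (Cols.short-moves g short (trans eq (col-ends same)))
    where
    col-ends : ∀ {x y z w} → SameEdge (g , h) (x , h) (z , y) (z , w) → x ≡ g
    col-ends (inj₁ (refl , refl)) = refl
    col-ends (inj₂ (refl , refl)) = refl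

  translate : V → ℕ × ℕ → V
  translate (x , y) (p₁ , p₂) = Cols.shift x p₁ , Rows.shift y p₂

  InBox : ℕ × ℕ → Set
  InBox (p₁ , p₂) = p₁ < m × p₂ < n

  translate-move : ∀ c t {p q} → Displace c p q → Move c (translate t p) (translate t q)
  translate-move (row , d) (x , y) {p₁ , p₂} (refl , refl) = refl , sym (Rows.shift-+ y p₂ d)
  translate-move (col , d) (x , y) {p₁ , p₂} (refl , refl) = refl , sym (Cols.shift-+ x p₁ d)

  translate-injective : ∀ t {p q} → InBox p → InBox q → translate t p ≡ translate t q → p ≡ q
  translate-injective t (p₁<m , p₂<n) (q₁<m , q₂<n) eq =
    cong₂ _,_ (Cols.shift-cancelˡ p₁<m q₁<m (cong proj₁ eq))
              (Rows.shift-cancelˡ p₂<n q₂<n (cong proj₂ eq))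

  translate-cancel : ∀ {t t' p} → InBox p → translate t p ≡ translate t' p → t ≡ t'
  translate-cancel (p₁<m , p₂<n) eq =
    cong₂ _,_ (Cols.shift-cancelʳ (<⇒≤ p₁<m) (cong proj₁ eq))
              (Rows.shift-cancelʳ (<⇒≤ p₂<n) (cong proj₂ eq))

  translate-solve : ∀ {p} → InBox p → ∀ u → Σ V λ t → translate t p ≡ u
  translate-solve {p₁ , p₂} (p₁<m , p₂<n) (g , h) =
    (Cols.shift g (m ∸ p₁) , Rows.shift h (n ∸ p₂)) ,
    cong₂ _,_ (Cols.shift-forth (<⇒≤ p₁<m) g) (Rows.shift-forth (<⇒≤ p₂<n) h)

  -- Translating every base block by every vertex
  -- decomposes K_m □ K_n (the classical difference method).

  record DifferenceFamily : Set₁ where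
    field
      Block       : Set
      #blocks     : ℕ
      enumerate   : Fin #blocks ↔ Block
      position    : Block → Fin 8 → ℕ × ℕ
      in-box      : ∀ β i → InBox (position β i)
      position-injective : ∀ β → Injective _≡_ _≡_ (position β)
      label       : Block → Fin 8 → Label
      orientation : Block → Fin 8 → Orientation
      admissible  : ∀ β e → Admissible (label β e)
      displace    : ∀ β e → Displace (label β e)
        (position β (tail (orientation β e) e)) (position β (head (orientation β e) e))
      label-injective  : ∀ β e β' e' → label β e ≡ label β' e' → β ≡ β' × e ≡ e'
      label-surjective : ∀ c → Admissible c → Σ Block λ β → Σ (Fin 8) λ e → label β e ≡ c

  module Development (F : DifferenceFamily) where
    open DifferenceFamily F

    copy : Block × V → Fin 8 → V
    copy (β , t) i = translate t (position β i)

    copy-step : ∀ β t e → Step (label β e)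
      (copy (β , t) (tail (orientation β e) e)) (copy (β , t) (head (orientation β e) e))
    copy-step β t e = admissible β e , translate-move (label β e) t (displace β e)

    Covers : Block × V → Fin 8 → V → V → Set
    Covers κ e u v = SameEdge (copy κ (src e)) (copy κ (tgt e)) u v

    -- A step is covered by the copy that moves the matching base edge onto it.
    cover-step : ∀ {c u v} → Step c u v → Σ (Block × V) λ κ → Σ (Fin 8) λ e → Covers κ e u v
    cover-step {c} {u} {v} (adm , move) with label-surjective c adm
    ... | β , e , refl with translate-solve (in-box β (tail (orientation β e) e)) u
    ...   | t , refl = (β , t) , e ,
      sameEdge-trans (sameEdge-sym (oriented-ends (copy (β , t)) (orientation β e) e))
                     (inj₁ (refl , move-functional (proj₂ (copy-step β t e)) move))

    covered : ∀ u v → Adj u v → Σ (Block × V) λ κ → Σ (Fin 8) λ e → Covers κ e u v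
    covered u v adj with adjacent-step adj
    ... | c , inj₁ step = cover-step step
    ... | c , inj₂ step = let (κ , e , cov) = cover-step step in κ , e , sameEdge-swap cov

    along : ∀ β t e {u v} → Covers (β , t) e u v →
      SameEdge (copy (β , t) (tail (orientation β e) e))
               (copy (β , t) (head (orientation β e) e)) u v
    along β t e = sameEdge-trans (oriented-ends (copy (β , t)) (orientation β e) e)

    -- Two copies covering the same edge carry the same label there, hence
    -- the same base edge, and start at the same vertex, hence coincide.
    unique : ∀ u v → Adj u v → ∀ κ e κ' e' →
      Covers κ e u v → Covers κ' e' u v → κ ≡ κ' × e ≡ e'
    unique u v _ (β , t) e (β' , t') e' cov cov'
      with step-unique (copy-step β t e) (copy-step β' t' e')
                       (sameEdge-trans (along β t e cov) (sameEdge-sym (along β' t' e' cov')))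
    ... | same-label , same-start with label-injective β e β' e' same-label
    ...   | refl , refl = cong (β ,_) (translate-cancel (in-box β _) same-start) , refl

    decomposition : IndexedL8-Decomposition Adj (Block × V)
    decomposition = record
      { copy      = copy
      ; injective = λ (β , t) eq →
          position-injective β (translate-injective t (in-box β _) (in-box β _) eq)
      ; edge-ok   = λ (β , t) e →
          adj-sameEdge (sameEdge-sym (oriented-ends (copy (β , t)) (orientation β e) e))
                       (step-adjacent (copy-step β t e))
      ; covered   = covered
      ; unique    = unique
      }

  develop : DifferenceFamily → L8-Decomposition Adj
  develop F = reindex (↔-trans *↔× (enumerate ×-↔ *↔×)) (Development.decomposition F)
    where open DifferenceFamily F

retraction-injective : {A B : Set} (f : A → B) (g : B → A) →
  (∀ x → g (f x) ≡ x) → Injective _≡_ _≡_ f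
retraction-injective f g gf {x} {y} eq = trans (sym (gf x)) (trans (cong g eq) (gf y))

increasing-injective : ∀ {k} {xs : Vec ℕ k} → Linked _<_ xs → Injective _≡_ _≡_ (lookup xs)
increasing-injective inc {i} {j} eq with Fin.<-cmp i j
... | tri< i<j _ _ = ⊥-elim (<⇒≢ (Linked.lookup⁺ <-trans inc i<j) eq)
... | tri≈ _ i≡j _ = i≡j
... | tri> _ _ j<i = ⊥-elim (<⇒≢ (Linked.lookup⁺ <-trans inc j<i) (sym eq))

increasing-≤-last : ∀ {k} {xs : Vec ℕ (suc k)} → Linked _<_ xs →
  ∀ i → lookup xs i ≤ lookup xs (fromℕ k)
increasing-≤-last inc i with i Fin.≟ fromℕ _
... | yes refl    = ≤-refl
... | no i≢last = <⇒≤ (Linked.lookup⁺ <-trans inc (Fin.≤∧≢⇒< (Fin.≤fromℕ i) i≢last))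

-- For every k the eight integers below carry a copy of L_8 whose edges have
-- the eight consecutive lengths k+5, …, k+12. With k = 8j these blocks
-- realise all lengths from 5 upwards, eight at a time.

lineVec : ℕ → Vec ℕ 8
lineVec k =
  0 ∷ k + 2 ∷ k + 5 ∷ k + 7 ∷ k + 12 ∷ k + (k + 13) ∷ k + (k + 14) ∷ k + (k + 17) ∷ []

lineVec-increasing : ∀ k → Linked _<_ (lineVec k)
lineVec-increasing k =
  ≤-trans (s≤s z≤n) (m≤n+m 2 k) ∷ +-monoʳ-< k (m<m+n 2 z<s) ∷ +-monoʳ-< k (m<m+n 5 z<s) ∷
  +-monoʳ-< k (m<m+n 7 z<s) ∷ +-monoʳ-< k (m≤n+m 13 k) ∷ +-monoʳ-< k (+-monoʳ-< k (m<m+n 13 z<s)) ∷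
  +-monoʳ-< k (+-monoʳ-< k (m<m+n 14 z<s)) ∷ [-]

-- Which entry of lineVec each vertex of L_8 occupies.
lineSlot : Fin 8 → Fin 8
lineSlot 0F = 0F
lineSlot 1F = 2F
lineSlot 2F = 5F
lineSlot 3F = 3F
lineSlot 4F = 4F
lineSlot 5F = 6F
lineSlot 6F = 1F
lineSlot 7F = 7F

lineSlot⁻¹ : Fin 8 → Fin 8
lineSlot⁻¹ 0F = 0F
lineSlot⁻¹ 1F = 6F
lineSlot⁻¹ 2F = 1F
lineSlot⁻¹ 3F = 3F
lineSlot⁻¹ 4F = 4F
lineSlot⁻¹ 5F = 2F
lineSlot⁻¹ 6F = 5F
lineSlot⁻¹ 7F = 7F

lineSlot-retraction : ∀ i → lineSlot⁻¹ (lineSlot i) ≡ i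
lineSlot-retraction 0F = refl
lineSlot-retraction 1F = refl
lineSlot-retraction 2F = refl
lineSlot-retraction 3F = refl
lineSlot-retraction 4F = refl
lineSlot-retraction 5F = refl
lineSlot-retraction 6F = refl
lineSlot-retraction 7F = refl

linePos : ℕ → Fin 8 → ℕ
linePos k i = lookup (lineVec k) (lineSlot i)

linePos-injective : ∀ k → Injective _≡_ _≡_ (linePos k)
linePos-injective k eq = retraction-injective lineSlot lineSlot⁻¹ lineSlot-retraction
  (increasing-injective (lineVec-increasing k) eq)

linePos-≤ : ∀ k i → linePos k i ≤ k + (k + 17)
linePos-≤ k i = increasing-≤-last {xs = lineVec k} (lineVec-increasing k) (lineSlot i)

-- Edge e has length k + 5 + lineOffset e, traversed in direction lineOrientation e.
lineOffset : Fin 8 → Fin 8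
lineOffset 0F = 0F
lineOffset 1F = 3F
lineOffset 2F = 1F
lineOffset 3F = 2F
lineOffset 4F = 7F
lineOffset 5F = 4F
lineOffset 6F = 6F
lineOffset 7F = 5F

lineOffset⁻¹ : Fin 8 → Fin 8
lineOffset⁻¹ 0F = 0F
lineOffset⁻¹ 1F = 2F
lineOffset⁻¹ 2F = 3F
lineOffset⁻¹ 3F = 1F
lineOffset⁻¹ 4F = 5F
lineOffset⁻¹ 5F = 7F
lineOffset⁻¹ 6F = 6F
lineOffset⁻¹ 7F = 4F

lineOffset-retraction : ∀ e → lineOffset⁻¹ (lineOffset e) ≡ e
lineOffset-retraction 0F = refl
lineOffset-retraction 1F = refl
lineOffset-retraction 2F = refl
lineOffset-retraction 3F = refl
lineOffset-retraction 4F = refl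
lineOffset-retraction 5F = refl
lineOffset-retraction 6F = refl
lineOffset-retraction 7F = refl

lineOffset-section : ∀ r → lineOffset (lineOffset⁻¹ r) ≡ r
lineOffset-section 0F = refl
lineOffset-section 1F = refl
lineOffset-section 2F = refl
lineOffset-section 3F = refl
lineOffset-section 4F = refl
lineOffset-section 5F = refl
lineOffset-section 6F = refl
lineOffset-section 7F = refl

lineOrientation : Fin 8 → Orientation
lineOrientation 0F = forward
lineOrientation 1F = forward
lineOrientation 2F = backward
lineOrientation 3F = backward
lineOrientation 4F = forward
lineOrientation 5F = forward
lineOrientation 6F = backward
lineOrientation 7F = forward

line-displace : ∀ k e → linePos k (head (lineOrientation e) e) ≡
  linePos k (tail (lineOrientation e) e) + (5 + (k + toℕ (lineOffset e)))
line-displace k 0F = length-0 k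
  where
  length-0 : ∀ k → k + 5 ≡ 0 + (5 + (k + 0))
  length-0 = solve-∀
line-displace k 1F = length-1 k
  where
  length-1 : ∀ k → k + (k + 13) ≡ k + 5 + (5 + (k + 3))
  length-1 = solve-∀
line-displace k 2F = length-2 k
  where
  length-2 : ∀ k → k + (k + 13) ≡ k + 7 + (5 + (k + 1))
  length-2 = solve-∀
line-displace k 3F = length-3 k
  where
  length-3 : ∀ k → k + 7 ≡ 0 + (5 + (k + 2))
  length-3 = solve-∀
line-displace k 4F = length-4 k
  where
  length-4 : ∀ k → k + 12 ≡ 0 + (5 + (k + 7))
  length-4 = solve-∀
line-displace k 5F = length-5 k
  where
  length-5 : ∀ k → k + (k + 14) ≡ k + 5 + (5 + (k + 4))
  length-5 = solve-∀
line-displace k 6F = length-6 k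
  where
  length-6 : ∀ k → k + (k + 13) ≡ k + 2 + (5 + (k + 6))
  length-6 = solve-∀
line-displace k 7F = length-7 k
  where
  length-7 : ∀ k → k + (k + 17) ≡ k + 7 + (5 + (k + 5))
  length-7 = solve-∀

-- A copy of L_8 in a 5 × 6 grid whose 4-cycle uses the row lengths
-- 1, 2, 3, 4 and whose pendant edges use the column lengths 1, 2, 3, 4.

mixedCell : Fin 8 → Fin 5 × Fin 6
mixedCell 0F = 0F , 0F
mixedCell 1F = 0F , 1F
mixedCell 2F = 0F , 5F
mixedCell 3F = 0F , 3F
mixedCell 4F = 1F , 0F
mixedCell 5F = 2F , 1F
mixedCell 6F = 3F , 5F
mixedCell 7F = 4F , 3F

mixedCell⁻¹ : Fin 5 × Fin 6 → Fin 8
mixedCell⁻¹ (0F , 0F) = 0F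
mixedCell⁻¹ (0F , 1F) = 1F
mixedCell⁻¹ (0F , 5F) = 2F
mixedCell⁻¹ (0F , 3F) = 3F
mixedCell⁻¹ (1F , 0F) = 4F
mixedCell⁻¹ (2F , 1F) = 5F
mixedCell⁻¹ (3F , 5F) = 6F
mixedCell⁻¹ (4F , 3F) = 7F
mixedCell⁻¹ _         = 0F

mixedCell-retraction : ∀ i → mixedCell⁻¹ (mixedCell i) ≡ i
mixedCell-retraction 0F = refl
mixedCell-retraction 1F = refl
mixedCell-retraction 2F = refl
mixedCell-retraction 3F = refl
mixedCell-retraction 4F = refl
mixedCell-retraction 5F = refl
mixedCell-retraction 6F = refl
mixedCell-retraction 7F = refl

mixedPos : Fin 8 → ℕ × ℕ
mixedPos i = toℕ (proj₁ (mixedCell i)) , toℕ (proj₂ (mixedCell i))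

mixedPos-injective : Injective _≡_ _≡_ mixedPos
mixedPos-injective eq = retraction-injective mixedCell mixedCell⁻¹ mixedCell-retraction
  (cong₂ _,_ (toℕ-injective (cong proj₁ eq)) (toℕ-injective (cong proj₂ eq)))

-- Edge e is a step of length 1 + r in direction δ, where (δ , r) = mixedKind e.
mixedKind : Fin 8 → Dir × Fin 4
mixedKind 0F = row , 0F
mixedKind 1F = row , 3F
mixedKind 2F = row , 1F
mixedKind 3F = row , 2F
mixedKind 4F = col , 0F
mixedKind 5F = col , 1F
mixedKind 6F = col , 2F
mixedKind 7F = col , 3F

mixedEdge : Dir × Fin 4 → Fin 8
mixedEdge (row , 0F) = 0F
mixedEdge (row , 3F) = 1F
mixedEdge (row , 1F) = 2F
mixedEdge (row , 2F) = 3F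
mixedEdge (col , 0F) = 4F
mixedEdge (col , 1F) = 5F
mixedEdge (col , 2F) = 6F
mixedEdge (col , 3F) = 7F

mixedKind-retraction : ∀ e → mixedEdge (mixedKind e) ≡ e
mixedKind-retraction 0F = refl
mixedKind-retraction 1F = refl
mixedKind-retraction 2F = refl
mixedKind-retraction 3F = refl
mixedKind-retraction 4F = refl
mixedKind-retraction 5F = refl
mixedKind-retraction 6F = refl
mixedKind-retraction 7F = refl

mixedKind-section : ∀ k → mixedKind (mixedEdge k) ≡ k
mixedKind-section (row , 0F) = refl
mixedKind-section (row , 1F) = refl
mixedKind-section (row , 2F) = refl
mixedKind-section (row , 3F) = refl
mixedKind-section (col , 0F) = refl
mixedKind-section (col , 1F) = refl
mixedKind-section (col , 2F) = refl
mixedKind-section (col , 3F) = refl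

mixedLabel : Fin 8 → Label
mixedLabel e = proj₁ (mixedKind e) , suc (toℕ (proj₂ (mixedKind e)))

mixedOrientation : Fin 8 → Orientation
mixedOrientation 0F = forward
mixedOrientation 1F = forward
mixedOrientation 2F = backward
mixedOrientation 3F = backward
mixedOrientation _  = forward

mixed-displace : ∀ e → Displace (mixedLabel e)
  (mixedPos (tail (mixedOrientation e) e)) (mixedPos (head (mixedOrientation e) e))
mixed-displace 0F = refl , refl
mixed-displace 1F = refl , refl
mixed-displace 2F = refl , refl
mixed-displace 3F = refl , refl
mixed-displace 4F = refl , refl
mixed-displace 5F = refl , refl
mixed-displace 6F = refl , refl
mixed-displace 7F = refl , refl

-- The difference family for m = 16a + 9 and n = 16b + 9, i.e. half-lengths
-- M = 8a + 4 and N = 8b + 4. The mixed block takes the row and column lengths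
-- 1, …, 4; for each direction δ and each j below a (columns) or b (rows), a
-- line block along δ takes the lengths 8j + 5, …, 8j + 12.

module Family (a b : ℕ) where

  open Torus (4 + a * 8) (4 + b * 8)

  count : Dir → ℕ
  count col = a
  count row = b

  half : Dir → ℕ
  half δ = 4 + count δ * 8

  admissible-intro : ∀ δ {d} → 1 ≤ d → d ≤ half δ → Admissible (δ , d)
  admissible-intro row 1≤d d≤half = 1≤d , d≤half
  admissible-intro col 1≤d d≤half = 1≤d , d≤half

  admissible-least : ∀ δ {d} → Admissible (δ , d) → 1 ≤ d
  admissible-least row = proj₁
  admissible-least col = proj₁

  admissible-bound : ∀ δ {d} → Admissible (δ , d) → d ≤ half δ
  admissible-bound row = proj₂
  admissible-bound col = proj₂

  place : Dir → ℕ → ℕ × ℕ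
  place row x = 0 , x
  place col x = x , 0

  place-injective : ∀ δ → Injective _≡_ _≡_ (place δ)
  place-injective row = cong proj₂
  place-injective col = cong proj₁

  place-in-box : ∀ δ {x} → x < suc (half δ + half δ) → InBox (place δ x)
  place-in-box row x< = s≤s z≤n , x<
  place-in-box col x< = x< , s≤s z≤n

  place-displace : ∀ δ {d x y} → y ≡ x + d → Displace (δ , d) (place δ x) (place δ y)
  place-displace row eq = refl , eq
  place-displace col eq = refl , eq

  line-fits : ∀ c (j : Fin c) → 8 * toℕ j + (8 * toℕ j + 17) < suc ((4 + c * 8) + (4 + c * 8))
  line-fits c j = begin-strict
    k + (k + 17)          ≡⟨ spread k ⟩
    (k + 8) + (k + 8) + 1 ≤⟨ +-monoˡ-≤ 1 (+-mono-≤ k+8≤c*8 k+8≤c*8) ⟩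
    c * 8 + c * 8 + 1     <⟨ +-monoʳ-< (c * 8 + c * 8) (m<m+n 1 z<s) ⟩
    c * 8 + c * 8 + 9     ≡⟨ gather (c * 8) ⟩
    suc ((4 + c * 8) + (4 + c * 8)) ∎
    where
    open ≤-Reasoning
    k = 8 * toℕ j
    k+8≤c*8 : k + 8 ≤ c * 8
    k+8≤c*8 = ≤-trans (≤-reflexive (trans (+-comm k 8) (cong (8 +_) (*-comm 8 (toℕ j)))))
                      (*-monoˡ-≤ 8 (toℕ<n j))
    spread : ∀ k → k + (k + 17) ≡ (k + 8) + (k + 8) + 1
    spread = solve-∀
    gather : ∀ C → C + C + 9 ≡ suc ((4 + C) + (4 + C))
    gather = solve-∀

  -- The box is at least 6 × 6, so the mixed block fits.
  box-corner : ∀ c → 6 ≤ suc ((4 + c * 8) + (4 + c * 8))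
  box-corner c = s≤s (+-monoʳ-≤ 4 (≤-trans (s≤s z≤n) (m≤n+m (4 + c * 8) (c * 8))))

  mixed-in-box : ∀ i → InBox (mixedPos i)
  mixed-in-box i = ≤-trans (toℕ<n (proj₁ (mixedCell i))) (≤-trans (n≤1+n 5) (box-corner a)) ,
                   ≤-trans (toℕ<n (proj₂ (mixedCell i))) (box-corner b)

  data Block : Set where
    mixed : Block
    line  : (δ : Dir) → Fin (count δ) → Block

  toBlock : Fin (suc (a + b)) → Block
  toBlock fzero    = mixed
  toBlock (fsuc i) = [ line col , line row ]′ (splitAt a i)

  fromBlock : Block → Fin (suc (a + b))
  fromBlock mixed        = fzero
  fromBlock (line col j) = fsuc (join a b (inj₁ j))
  fromBlock (line row j) = fsuc (join a b (inj₂ j))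

  toBlock-fromBlock : ∀ β → toBlock (fromBlock β) ≡ β
  toBlock-fromBlock mixed        = refl
  toBlock-fromBlock (line col j) = cong [ line col , line row ]′ (splitAt-join a b (inj₁ j))
  toBlock-fromBlock (line row j) = cong [ line col , line row ]′ (splitAt-join a b (inj₂ j))

  fromBlock-toBlock : ∀ i → fromBlock (toBlock i) ≡ i
  fromBlock-toBlock fzero    = refl
  fromBlock-toBlock (fsuc i) = trans (fromBlock-line (splitAt a i)) (cong fsuc (join-splitAt a b i))
    where
    fromBlock-line : ∀ s → fromBlock ([ line col , line row ]′ s) ≡ fsuc (join a b s)
    fromBlock-line (inj₁ j) = refl
    fromBlock-line (inj₂ j) = refl

  blocks : Fin (suc (a + b)) ↔ Block
  blocks = mk↔ₛ′ toBlock fromBlock toBlock-fromBlock fromBlock-toBlock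

  -- Base edge e of the j-th line block has length 5 + 8j + lineOffset e.
  lineLength : ∀ {c} → Fin c → Fin 8 → ℕ
  lineLength j e = 5 + toℕ (combine j (lineOffset e))

  position : Block → Fin 8 → ℕ × ℕ
  position mixed      = mixedPos
  position (line δ j) = place δ ∘ linePos (8 * toℕ j)

  label : Block → Fin 8 → Label
  label mixed      = mixedLabel
  label (line δ j) e = δ , lineLength j e

  orientation : Block → Fin 8 → Orientation
  orientation mixed      = mixedOrientation
  orientation (line δ j) = lineOrientation

  in-box : ∀ β i → InBox (position β i)
  in-box mixed      i = mixed-in-box i
  in-box (line δ j) i =
    place-in-box δ (≤-<-trans (linePos-≤ (8 * toℕ j) i) (line-fits (count δ) j))

  position-injective : ∀ β → Injective _≡_ _≡_ (position β)
  position-injective mixed      = mixedPos-injective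
  position-injective (line δ j) = linePos-injective (8 * toℕ j) ∘ place-injective δ

  admissible : ∀ β e → Admissible (label β e)
  admissible mixed e = admissible-intro (proj₁ (mixedKind e)) (s≤s z≤n)
    (≤-trans (toℕ<n (proj₂ (mixedKind e))) (m≤m+n 4 _))
  admissible (line δ j) e =
    admissible-intro δ (s≤s z≤n) (+-monoʳ-≤ 4 (toℕ<n (combine j (lineOffset e))))

  displace : ∀ β e → Displace (label β e)
    (position β (tail (orientation β e) e)) (position β (head (orientation β e) e))
  displace mixed      e = mixed-displace e
  displace (line δ j) e = place-displace δ (trans (line-displace k e)
    (cong (λ x → linePos k (tail (lineOrientation e) e) + (5 + x)) (sym (toℕ-combine j (lineOffset e)))))
    where k = 8 * toℕ j

  -- Mixed lengths are at most 4, line lengths at least 5.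
  mixed≢line : ∀ e {c} (j : Fin c) e' → proj₂ (mixedLabel e) ≢ lineLength j e'
  mixed≢line e j e' eq =
    <⇒≱ (toℕ<n (proj₂ (mixedKind e))) (≤-trans (m≤m+n 4 _) (≤-reflexive (sym (suc-injective eq))))

  label-injective : ∀ β e β' e' → label β e ≡ label β' e' → β ≡ β' × e ≡ e'
  label-injective mixed e mixed e' eq =
    refl , retraction-injective mixedKind mixedEdge mixedKind-retraction
      (cong₂ _,_ (cong proj₁ eq) (toℕ-injective (suc-injective (cong proj₂ eq))))
  label-injective mixed e (line δ j) e' eq = ⊥-elim (mixed≢line e j e' (cong proj₂ eq))
  label-injective (line δ j) e mixed e' eq = ⊥-elim (mixed≢line e' j e (cong proj₂ (sym eq)))
  label-injective (line δ j) e (line δ' j') e' eq with cong proj₁ eq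
  ... | refl with combine-injective j (lineOffset e) j' (lineOffset e')
                    (toℕ-injective (+-cancelˡ-≡ 5 _ _ (cong proj₂ eq)))
  ...   | refl , same-offset =
    refl , retraction-injective lineOffset lineOffset⁻¹ lineOffset-retraction same-offset

  mixed-surjective : ∀ δ {d} → 1 ≤ d → d ≤ 4 → Σ (Fin 8) λ e → mixedLabel e ≡ (δ , d)
  mixed-surjective δ {suc d} _ d<4 = mixedEdge (δ , fromℕ< d<4) ,
    trans (cong (λ k → proj₁ k , suc (toℕ (proj₂ k))) (mixedKind-section (δ , fromℕ< d<4)))
          (cong (λ x → δ , suc x) (toℕ-fromℕ< d<4))

  line-surjective : ∀ δ t → 5 + t ≤ half δ →
    Σ (Fin (count δ)) λ j → Σ (Fin 8) λ e → lineLength j e ≡ 5 + t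
  line-surjective δ t 5+t≤half = j , lineOffset⁻¹ r , cong (5 +_) (begin
    toℕ (combine j (lineOffset (lineOffset⁻¹ r)))   ≡⟨ cong (toℕ ∘ combine j) (lineOffset-section r) ⟩
    toℕ (combine j r)                                ≡⟨ cong toℕ (combine-remQuot {count δ} 8 x) ⟩
    toℕ x                                            ≡⟨ toℕ-fromℕ< t<c*8 ⟩
    t                                                ∎)
    where
    open ≡-Reasoning
    t<c*8 : t < count δ * 8
    t<c*8 = +-cancelˡ-≤ 4 _ _ 5+t≤half
    x = fromℕ< t<c*8
    j = proj₁ (remQuot {count δ} 8 x)
    r = proj₂ (remQuot {count δ} 8 x)

  line-covers : ∀ δ {d} → 5 ≤ d → d ≤ half δ →
    Σ Block λ β → Σ (Fin 8) λ e → label β e ≡ (δ , d)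
  line-covers δ {d} 5≤d d≤half =
    let (j , e , eq) = line-surjective δ (d ∸ 5) (≤-trans (≤-reflexive 5+t≡d) d≤half)
    in line δ j , e , cong (δ ,_) (trans eq 5+t≡d)
    where
    5+t≡d : 5 + (d ∸ 5) ≡ d
    5+t≡d = m+[n∸m]≡n 5≤d

  label-surjective : ∀ c → Admissible c → Σ Block λ β → Σ (Fin 8) λ e → label β e ≡ c
  label-surjective (δ , d) adm with d ≤? 4
  ... | yes d≤4 = mixed , mixed-surjective δ (admissible-least δ adm) d≤4
  ... | no d≰4  = line-covers δ (≰⇒> d≰4) (admissible-bound δ adm)

  family : DifferenceFamily
  family = record
    { Block              = Block
    ; enumerate          = blocks
    ; position           = position
    ; in-box             = in-box
    ; position-injective = position-injective
    ; label              = label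
    ; orientation        = orientation
    ; admissible         = admissible
    ; displace           = displace
    ; label-injective    = label-injective
    ; label-surjective   = label-surjective
    }

shape : ∀ m → m % 16 ≡ 9 → m ≡ suc ((4 + (m / 16) * 8) + (4 + (m / 16) * 8))
shape m m%16≡9 = begin
  m                                             ≡⟨ m≡m%n+[m/n]*n m 16 ⟩
  m % 16 + (m / 16) * 16                        ≡⟨ cong (_+ (m / 16) * 16) m%16≡9 ⟩
  9 + (m / 16) * 16                             ≡⟨ halve (m / 16) ⟩
  suc ((4 + (m / 16) * 8) + (4 + (m / 16) * 8)) ∎
  where
  open ≡-Reasoning
  halve : ∀ q → 9 + q * 16 ≡ suc ((4 + q * 8) + (4 + q * 8))
  halve = solve-∀

lemma2p9 : (m n : ℕ) → m ≥ 1 → n ≥ 1 → m % 16 ≡ 9 → n % 16 ≡ 9 →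
    L8-Decomposition (KmBoxKn-Adj m n)
lemma2p9 m n _ _ m%16≡9 n%16≡9 =
  subst₂ (λ m n → L8-Decomposition (KmBoxKn-Adj m n))
         (sym (shape m m%16≡9)) (sym (shape n n%16≡9))
    (Torus.develop (4 + a * 8) (4 + b * 8) (Family.family a b))
  where
  a = m / 16
  b = n / 16
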